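{- Let $A$ be an MV-algebra with lattice spectrum $X$ and map $k\colon X\to Y$ as in the context. If $x,x'\in X$ satisfy $x\le x'$, then there exists $x''\in X$ with $x\le x''\le x'$, $k(x'')\ge k(x)$ and $k(x'')\ge k(x')$.
   Context: MV-algebra $(A,\oplus,\neg,0)$: $(A,\oplus,0)$ commutative monoid, $\neg\neg x=x$, $x\oplus\neg0=\neg0$, $\neg(\neg x\oplus y)\oplus y=\neg(\neg y\oplus x)\oplus x$; $x\ominus y:=\neg(\neg x\oplus y)$; lattice operations $x\vee y:=\neg(\neg x\oplus y)\oplus y$, $x\wedge y:=\neg(\neg x\vee\neg y)$. MV-ideal: downset containing $0$ closed under $\oplus$; prime if proper and for all $a,b$, $a\ominus b$ or $b\ominus a$ lies in it. $X$: set of prime lattice ideals of the lattice reduct, $I_x$ the ideal of $x$, $x\le x'$ iff $I_x\subseteq I_{x'}$. $Y\subseteq X$: points whose ideals are prime MV-ideals. $I\,\overline{\oplus}\,J:=\{c:\exists a\in I,b\in J,\ c\le a\oplus b\}$. $k\colon X\to Y$: $I_{k(x)}$ is the largest lattice ideal $J$ with $I_x\,\overline{\oplus}\,J\subseteq I_x$ (it exists and is a prime MV-ideal). -}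

module Defs where

open import Level using (Level; _⊔_) renaming (suc to lsuc)
open import Data.Product using (Σ; ∃; _×_; _,_)
open import Data.Sum using (_⊎_)
open import Relation.Nullary using (¬_)
open import Relation.Unary using (Pred; _∈_; _∉_; _⊆_)
open import Relation.Binary.PropositionalEquality using (_≡_)

record MVAlgebra (c : Level) : Set (lsuc c) where
  infixl 6 _⊕_
  infix 4 _≤_
  infixl 7 _∧_
  infixl 6 _∨_ _⊖_
  field
    Carrier : Set c
    _⊕_     : Carrier → Carrier → Carrier
    neg     : Carrier → Carrier
    0#      : Carrier
    ⊕-assoc    : ∀ x y z → (x ⊕ y) ⊕ z ≡ x ⊕ (y ⊕ z)
    ⊕-comm     : ∀ x y → x ⊕ y ≡ y ⊕ x
    ⊕-identityʳ : ∀ x → x ⊕ 0# ≡ x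
    neg-involutive : ∀ x → neg (neg x) ≡ x
    ⊕-absorb   : ∀ x → x ⊕ neg 0# ≡ neg 0#
    luk        : ∀ x y → neg (neg x ⊕ y) ⊕ y ≡ neg (neg y ⊕ x) ⊕ x

  _⊖_ : Carrier → Carrier → Carrier
  x ⊖ y = neg (neg x ⊕ y)

  _∨_ : Carrier → Carrier → Carrier
  x ∨ y = neg (neg x ⊕ y) ⊕ y

  _∧_ : Carrier → Carrier → Carrier
  x ∧ y = neg (neg x ∨ neg y)

  _≤_ : Carrier → Carrier → Set c
  x ≤ y = x ∨ y ≡ y

  record IsLatticeIdeal (I : Pred Carrier c) : Set c where
    field
      nonempty : ∃ λ a → a ∈ I
      downward : ∀ {a b} → a ≤ b → b ∈ I → a ∈ I
      ∨-closed : ∀ {a b} → a ∈ I → b ∈ I → (a ∨ b) ∈ I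

  record IsPrimeLatticeIdeal (I : Pred Carrier c) : Set c where
    field
      isLatticeIdeal : IsLatticeIdeal I
      proper         : ∃ λ a → a ∉ I
      prime          : ∀ {a b} → (a ∧ b) ∈ I → a ∈ I ⊎ b ∈ I

  _⊕̄_ : Pred Carrier c → Pred Carrier c → Pred Carrier c
  (I ⊕̄ J) x = ∃ λ a → ∃ λ b → a ∈ I × b ∈ J × x ≤ a ⊕ b

  -- K is the ideal of k(x) where I is the ideal of x:
  -- K is the largest lattice ideal J with I ⊕̄ J ⊆ I.
  IsK : Pred Carrier c → Pred Carrier c → Set (lsuc c)
  IsK I K = IsLatticeIdeal K × (I ⊕̄ K) ⊆ I
          × (∀ (J : Pred Carrier c) → IsLatticeIdeal J → (I ⊕̄ J) ⊆ I → J ⊆ K)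

-- Let Stab I′ = { b : a ⊕ b ∈ I′ for all a ∈ I′ }, the ideal of k(x′); the middle point
-- is I″ = I ⊕̄ Stab I′. It lies between I and I′, and it is prime because I is: if
-- x ∧ y ≤ a ⊕ b with a ∈ I, then by prelinearity (x ⊖ y) ∧ (y ⊖ x) = 0, so
-- (a ⊕ (x ⊖ y)) ∧ (a ⊕ (y ⊖ x)) ≤ a ∈ I and one of the two summands lies in I, while
-- x ≤ (x ∧ y) ⊕ (x ⊖ y). Finally k(x″) lies above k(x) and k(x′) by maximality: a lattice
-- ideal K absorbed by I (or by I′, hence by Stab I′) is absorbed by I ⊕̄ Stab I′.
module Submission where

open import Defs
open import Level using (Level)
open import Algebra.Bundles using (CommutativeSemigroup)
import Algebra.Properties.CommutativeSemigroup as CommutativeSemigroupProperties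
open import Data.Product using (Σ; ∃; _×_; _,_)
open import Data.Sum using (_⊎_)
import Data.Sum as Sum
open import Function using (_∘_)
open import Relation.Binary.Bundles using (Preorder)
import Relation.Binary.Reasoning.Preorder as PreorderReasoning
open import Relation.Binary.PropositionalEquality
open import Relation.Unary using (Pred; _∈_; _∉_; _⊆_)

module MVAlgebraProperties {c : Level} (A : MVAlgebra c) where
  open MVAlgebra A

  ⊕-commutativeSemigroup : CommutativeSemigroup c c
  ⊕-commutativeSemigroup = record
    { Carrier = Carrier
    ; _≈_ = _≡_
    ; _∙_ = _⊕_
    ; isCommutativeSemigroup = record
      { isSemigroup = record
        { isMagma = record { isEquivalence = isEquivalence ; ∙-cong = cong₂ _⊕_ }
        ; assoc = ⊕-assoc
        }
      ; comm = ⊕-comm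
      }
    }

  open CommutativeSemigroupProperties ⊕-commutativeSemigroup
    using (xy∙z≈xz∙y; x∙yz≈y∙xz) public

  1# : Carrier
  1# = neg 0#

  ⊕-identityˡ : ∀ x → 0# ⊕ x ≡ x
  ⊕-identityˡ x = trans (⊕-comm 0# x) (⊕-identityʳ x)

  ⊕-zeroˡ : ∀ x → 1# ⊕ x ≡ 1#
  ⊕-zeroˡ x = trans (⊕-comm 1# x) (⊕-absorb x)

  ∨-comm : ∀ x y → x ∨ y ≡ y ∨ x
  ∨-comm = luk

  neg-inverseˡ : ∀ x → neg x ⊕ x ≡ 1#
  neg-inverseˡ x = begin
    neg x ⊕ x               ≡⟨ cong (λ t → neg t ⊕ x) (sym (⊕-identityˡ x)) ⟩
    neg (0# ⊕ x) ⊕ x        ≡⟨ cong (λ t → neg (t ⊕ x) ⊕ x) (sym (neg-involutive 0#)) ⟩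
    1# ∨ x                  ≡⟨ ∨-comm 1# x ⟩
    x ∨ 1#                  ≡⟨ ⊕-absorb _ ⟩
    1#                      ∎
    where open ≡-Reasoning

  neg[x]⊕[x⊕y]≡1 : ∀ x y → neg x ⊕ (x ⊕ y) ≡ 1#
  neg[x]⊕[x⊕y]≡1 x y = begin
    neg x ⊕ (x ⊕ y)  ≡⟨ sym (⊕-assoc _ _ _) ⟩
    (neg x ⊕ x) ⊕ y  ≡⟨ cong (_⊕ y) (neg-inverseˡ x) ⟩
    1# ⊕ y           ≡⟨ ⊕-zeroˡ y ⟩
    1#               ∎
    where open ≡-Reasoning

  neg⊕≡1⇒≤ : ∀ {x y} → neg x ⊕ y ≡ 1# → x ≤ y
  neg⊕≡1⇒≤ {x} {y} eq = begin
    neg (neg x ⊕ y) ⊕ y  ≡⟨ cong (λ t → neg t ⊕ y) eq ⟩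
    neg 1# ⊕ y           ≡⟨ cong (_⊕ y) (neg-involutive 0#) ⟩
    0# ⊕ y               ≡⟨ ⊕-identityˡ y ⟩
    y                    ∎
    where open ≡-Reasoning

  x≤x⊕y : ∀ x y → x ≤ x ⊕ y
  x≤x⊕y x y = neg⊕≡1⇒≤ (neg[x]⊕[x⊕y]≡1 x y)

  x⊕[y⊖x]≡y : ∀ {x y} → x ≤ y → x ⊕ (y ⊖ x) ≡ y
  x⊕[y⊖x]≡y {x} {y} x≤y = trans (⊕-comm x (y ⊖ x)) (trans (luk y x) x≤y)

  ≤⇒neg⊕≡1 : ∀ {x y} → x ≤ y → neg x ⊕ y ≡ 1#
  ≤⇒neg⊕≡1 {x} x≤y = subst (λ t → neg x ⊕ t ≡ 1#) (x⊕[y⊖x]≡y x≤y) (neg[x]⊕[x⊕y]≡1 x _)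

  ≤-refl : ∀ x → x ≤ x
  ≤-refl x = neg⊕≡1⇒≤ (neg-inverseˡ x)

  ≤-trans : ∀ {x y z} → x ≤ y → y ≤ z → x ≤ z
  ≤-trans {x} {y} {z} x≤y y≤z = subst (x ≤_) x⊕[[y⊖x]⊕[z⊖y]]≡z (x≤x⊕y x _)
    where
    x⊕[[y⊖x]⊕[z⊖y]]≡z : x ⊕ ((y ⊖ x) ⊕ (z ⊖ y)) ≡ z
    x⊕[[y⊖x]⊕[z⊖y]]≡z = begin
      x ⊕ ((y ⊖ x) ⊕ (z ⊖ y))  ≡⟨ sym (⊕-assoc _ _ _) ⟩
      (x ⊕ (y ⊖ x)) ⊕ (z ⊖ y)  ≡⟨ cong (_⊕ (z ⊖ y)) (x⊕[y⊖x]≡y x≤y) ⟩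
      y ⊕ (z ⊖ y)              ≡⟨ x⊕[y⊖x]≡y y≤z ⟩
      z                        ∎
      where open ≡-Reasoning

  ≤-preorder : Preorder c c c
  ≤-preorder = record
    { Carrier = Carrier
    ; _≈_ = _≡_
    ; _≲_ = _≤_
    ; isPreorder = record
      { isEquivalence = isEquivalence
      ; reflexive = λ { refl → ≤-refl _ }
      ; trans = ≤-trans
      }
    }

  module ≤-Reasoning = PreorderReasoning ≤-preorder

  0≤x : ∀ x → 0# ≤ x
  0≤x x = neg⊕≡1⇒≤ (⊕-zeroˡ x)

  ⊕-monoˡ-≤ : ∀ {x y} z → x ≤ y → x ⊕ z ≤ y ⊕ z
  ⊕-monoˡ-≤ {x} {y} z x≤y = subst (x ⊕ z ≤_) [x⊕z]⊕[y⊖x]≡y⊕z (x≤x⊕y (x ⊕ z) (y ⊖ x))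
    where
    [x⊕z]⊕[y⊖x]≡y⊕z : (x ⊕ z) ⊕ (y ⊖ x) ≡ y ⊕ z
    [x⊕z]⊕[y⊖x]≡y⊕z = trans (xy∙z≈xz∙y x z (y ⊖ x)) (cong (_⊕ z) (x⊕[y⊖x]≡y x≤y))

  ⊕-monoʳ-≤ : ∀ {x y} z → x ≤ y → z ⊕ x ≤ z ⊕ y
  ⊕-monoʳ-≤ {x} {y} z x≤y =
    subst₂ _≤_ (⊕-comm x z) (⊕-comm y z) (⊕-monoˡ-≤ z x≤y)

  ⊕-mono-≤ : ∀ {x x′ y y′} → x ≤ x′ → y ≤ y′ → x ⊕ y ≤ x′ ⊕ y′
  ⊕-mono-≤ {x′ = x′} {y} x≤x′ y≤y′ = ≤-trans (⊕-monoˡ-≤ y x≤x′) (⊕-monoʳ-≤ x′ y≤y′)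

  neg-antitone-≤ : ∀ {x y} → x ≤ y → neg y ≤ neg x
  neg-antitone-≤ {x} {y} x≤y = neg⊕≡1⇒≤ (begin
    neg (neg y) ⊕ neg x  ≡⟨ cong (_⊕ neg x) (neg-involutive y) ⟩
    y ⊕ neg x            ≡⟨ ⊕-comm y (neg x) ⟩
    neg x ⊕ y            ≡⟨ ≤⇒neg⊕≡1 x≤y ⟩
    1#                   ∎)
    where open ≡-Reasoning

  x≤y⊕z⇒x⊖y≤z : ∀ {x y z} → x ≤ y ⊕ z → x ⊖ y ≤ z
  x≤y⊕z⇒x⊖y≤z {x} {y} {z} x≤y⊕z = neg⊕≡1⇒≤ (begin
    neg (x ⊖ y) ⊕ z    ≡⟨ cong (_⊕ z) (neg-involutive _) ⟩
    (neg x ⊕ y) ⊕ z    ≡⟨ ⊕-assoc _ _ _ ⟩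
    neg x ⊕ (y ⊕ z)    ≡⟨ ≤⇒neg⊕≡1 x≤y⊕z ⟩
    1#                 ∎)
    where open ≡-Reasoning

  x⊖y≤z⇒x≤y⊕z : ∀ {x y z} → x ⊖ y ≤ z → x ≤ y ⊕ z
  x⊖y≤z⇒x≤y⊕z {x} {y} {z} x⊖y≤z = neg⊕≡1⇒≤ (begin
    neg x ⊕ (y ⊕ z)    ≡⟨ sym (⊕-assoc _ _ _) ⟩
    (neg x ⊕ y) ⊕ z    ≡⟨ cong (_⊕ z) (sym (neg-involutive _)) ⟩
    neg (x ⊖ y) ⊕ z    ≡⟨ ≤⇒neg⊕≡1 x⊖y≤z ⟩
    1#                 ∎)
    where open ≡-Reasoning

  x⊖y≤x : ∀ x y → x ⊖ y ≤ x
  x⊖y≤x x y = subst (x ⊖ y ≤_) (neg-involutive x) (neg-antitone-≤ (x≤x⊕y (neg x) y))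

  x≤y∨x : ∀ x y → x ≤ y ∨ x
  x≤y∨x x y = subst (x ≤_) (⊕-comm x (y ⊖ x)) (x≤x⊕y x (y ⊖ x))

  x≤x∨y : ∀ x y → x ≤ x ∨ y
  x≤x∨y x y = subst (x ≤_) (∨-comm y x) (x≤y∨x x y)

  ∨-monoˡ-≤ : ∀ {x y} z → x ≤ y → x ∨ z ≤ y ∨ z
  ∨-monoˡ-≤ z x≤y = ⊕-monoˡ-≤ z (neg-antitone-≤ (⊕-monoˡ-≤ z (neg-antitone-≤ x≤y)))

  ∨-lub : ∀ {x y z} → x ≤ z → y ≤ z → x ∨ y ≤ z
  ∨-lub {x} {y} {z} x≤z y≤z = subst (x ∨ y ≤_) (trans (∨-comm z y) y≤z) (∨-monoˡ-≤ y x≤z)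

  x∨y≤x⊕y : ∀ x y → x ∨ y ≤ x ⊕ y
  x∨y≤x⊕y x y = ∨-lub (x≤x⊕y x y) (subst (y ≤_) (⊕-comm y x) (x≤x⊕y y x))

  x∧y≤x : ∀ x y → x ∧ y ≤ x
  x∧y≤x x y = subst (x ∧ y ≤_) (neg-involutive x) (neg-antitone-≤ (x≤x∨y (neg x) (neg y)))

  x∧y≤y : ∀ x y → x ∧ y ≤ y
  x∧y≤y x y = subst (x ∧ y ≤_) (neg-involutive y) (neg-antitone-≤ (x≤y∨x (neg y) (neg x)))

  ∧-glb : ∀ {x y z} → z ≤ x → z ≤ y → z ≤ x ∧ y
  ∧-glb {x} {y} {z} z≤x z≤y =
    subst (_≤ x ∧ y) (neg-involutive z) (neg-antitone-≤ (∨-lub (neg-antitone-≤ z≤x) (neg-antitone-≤ z≤y)))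

  ∧-comm : ∀ x y → x ∧ y ≡ y ∧ x
  ∧-comm x y = cong neg (∨-comm (neg x) (neg y))

  [x⊕y]∧[x⊕z]≤x⊕[y∧z] : ∀ x y z → (x ⊕ y) ∧ (x ⊕ z) ≤ x ⊕ (y ∧ z)
  [x⊕y]∧[x⊕z]≤x⊕[y∧z] x y z = x⊖y≤z⇒x≤y⊕z
    (∧-glb (x≤y⊕z⇒x⊖y≤z (x∧y≤x _ _)) (x≤y⊕z⇒x⊖y≤z (x∧y≤y _ _)))

  x∧y≡x⊖[x⊖y] : ∀ x y → x ∧ y ≡ x ⊖ (x ⊖ y)
  x∧y≡x⊖[x⊖y] x y = begin
    x ∧ y                                    ≡⟨ ∧-comm x y ⟩
    neg (neg y ∨ neg x)                      ≡⟨ cong (λ t → neg (neg (t ⊕ neg x) ⊕ neg x)) (neg-involutive y) ⟩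
    neg (neg (y ⊕ neg x) ⊕ neg x)            ≡⟨ cong (λ t → neg (neg t ⊕ neg x)) (⊕-comm y (neg x)) ⟩
    neg (neg (neg x ⊕ y) ⊕ neg x)            ≡⟨ cong neg (⊕-comm _ _) ⟩
    x ⊖ (x ⊖ y)                              ∎
    where open ≡-Reasoning

  [x⊖y]⊕[x∧y]≡x : ∀ x y → (x ⊖ y) ⊕ (x ∧ y) ≡ x
  [x⊖y]⊕[x∧y]≡x x y =
    trans (cong ((x ⊖ y) ⊕_) (x∧y≡x⊖[x⊖y] x y)) (x⊕[y⊖x]≡y (x⊖y≤x x y))

  neg[y]⊕[x∧y]≡neg[y]⊕x : ∀ x y → neg y ⊕ (x ∧ y) ≡ neg y ⊕ x
  neg[y]⊕[x∧y]≡neg[y]⊕x x y = begin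
    neg y ⊕ (x ∧ y)                    ≡⟨ cong (neg y ⊕_) (trans (∧-comm x y) (x∧y≡x⊖[x⊖y] y x)) ⟩
    neg y ⊕ neg (neg y ⊕ neg (neg y ⊕ x))  ≡⟨ cong (λ t → neg y ⊕ neg t) (⊕-comm _ _) ⟩
    neg y ⊕ ((neg y ⊕ x) ⊖ neg y)      ≡⟨ x⊕[y⊖x]≡y (x≤x⊕y (neg y) x) ⟩
    neg y ⊕ x                          ∎
    where open ≡-Reasoning

  [x⊖y]⊕[neg[y]⊕x]≡neg[y]⊕x : ∀ x y → (x ⊖ y) ⊕ (neg y ⊕ x) ≡ neg y ⊕ x
  [x⊖y]⊕[neg[y]⊕x]≡neg[y]⊕x x y = begin
    (x ⊖ y) ⊕ (neg y ⊕ x)            ≡⟨ cong ((x ⊖ y) ⊕_) (sym (neg[y]⊕[x∧y]≡neg[y]⊕x x y)) ⟩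
    (x ⊖ y) ⊕ (neg y ⊕ (x ∧ y))      ≡⟨ x∙yz≈y∙xz _ _ _ ⟩
    neg y ⊕ ((x ⊖ y) ⊕ (x ∧ y))      ≡⟨ cong (neg y ⊕_) ([x⊖y]⊕[x∧y]≡x x y) ⟩
    neg y ⊕ x                        ∎
    where open ≡-Reasoning

  prelinearity : ∀ x y → (neg x ⊕ y) ∨ (neg y ⊕ x) ≡ 1#
  prelinearity x y =
    trans (cong (λ t → neg t ⊕ (neg y ⊕ x)) ([x⊖y]⊕[neg[y]⊕x]≡neg[y]⊕x x y))
          (neg-inverseˡ _)

  [x⊖y]∧[y⊖x]≡0 : ∀ x y → (x ⊖ y) ∧ (y ⊖ x) ≡ 0#
  [x⊖y]∧[y⊖x]≡0 x y = begin
    neg (neg (x ⊖ y) ∨ neg (y ⊖ x))   ≡⟨ cong neg (cong₂ _∨_ (neg-involutive _) (neg-involutive _)) ⟩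
    neg ((neg x ⊕ y) ∨ (neg y ⊕ x))   ≡⟨ cong neg (prelinearity x y) ⟩
    neg 1#                            ≡⟨ neg-involutive 0# ⟩
    0#                                ∎
    where open ≡-Reasoning

module IdealArithmetic {c : Level} (A : MVAlgebra c) where
  open MVAlgebra A
  open MVAlgebraProperties A

  Stab : Pred Carrier c → Pred Carrier c
  Stab I b = ∀ a → a ∈ I → a ⊕ b ∈ I

  module _ {I : Pred Carrier c} (I-ideal : IsLatticeIdeal I) where
    open IsLatticeIdeal I-ideal

    0∈ideal : 0# ∈ I
    0∈ideal = let (a , a∈I) = nonempty in downward (0≤x a) a∈I

    Stab-isLatticeIdeal : IsLatticeIdeal (Stab I)
    Stab-isLatticeIdeal = record
      { nonempty = 0# , λ a a∈I → subst (_∈ I) (sym (⊕-identityʳ a)) a∈I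
      ; downward = λ b′≤b b∈S a a∈I → downward (⊕-monoʳ-≤ a b′≤b) (b∈S a a∈I)
      ; ∨-closed = λ {b} {b′} b∈S b′∈S a a∈I → downward
          (⊕-monoʳ-≤ a (x∨y≤x⊕y b b′))
          (subst (_∈ I) (⊕-assoc a b b′) (b′∈S (a ⊕ b) (b∈S a a∈I)))
      }

    ⊕̄-Stab-⊆ : I ⊕̄ Stab I ⊆ I
    ⊕̄-Stab-⊆ (a , b , a∈I , b∈S , x≤a⊕b) = downward x≤a⊕b (b∈S a a∈I)

    Stab-absorbs : ∀ {K} → I ⊕̄ K ⊆ I → Stab I ⊕̄ K ⊆ Stab I
    Stab-absorbs I⊕̄K⊆I {x} (b , k , b∈S , k∈K , x≤b⊕k) a a∈I =
      downward a⊕x≤[a⊕b]⊕k (I⊕̄K⊆I (a ⊕ b , k , b∈S a a∈I , k∈K , ≤-refl _))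
      where
      open ≤-Reasoning
      a⊕x≤[a⊕b]⊕k : a ⊕ x ≤ (a ⊕ b) ⊕ k
      a⊕x≤[a⊕b]⊕k = begin
        a ⊕ x        ≲⟨ ⊕-monoʳ-≤ a x≤b⊕k ⟩
        a ⊕ (b ⊕ k)  ≡⟨ ⊕-assoc a b k ⟨
        (a ⊕ b) ⊕ k  ∎

  ⊕̄-monoˡ : ∀ {I I′ J : Pred Carrier c} → I ⊆ I′ → I ⊕̄ J ⊆ I′ ⊕̄ J
  ⊕̄-monoˡ I⊆I′ (a , b , a∈I , b∈J , x≤a⊕b) = a , b , I⊆I′ a∈I , b∈J , x≤a⊕b

  ⊕̄-monoʳ : ∀ {I J J′ : Pred Carrier c} → J ⊆ J′ → I ⊕̄ J ⊆ I ⊕̄ J′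
  ⊕̄-monoʳ J⊆J′ (a , b , a∈I , b∈J , x≤a⊕b) = a , b , a∈I , J⊆J′ b∈J , x≤a⊕b

  ⊆-⊕̄ : ∀ {I J : Pred Carrier c} → 0# ∈ J → I ⊆ I ⊕̄ J
  ⊆-⊕̄ 0∈J {x} x∈I = x , 0# , x∈I , 0∈J , x≤x⊕y x 0#

  [I⊕̄J]⊕̄K⊆I⊕̄[J⊕̄K] : ∀ {I J K : Pred Carrier c} → (I ⊕̄ J) ⊕̄ K ⊆ I ⊕̄ (J ⊕̄ K)
  [I⊕̄J]⊕̄K⊆I⊕̄[J⊕̄K] {x = x} (e , k , (a , b , a∈I , b∈J , e≤a⊕b) , k∈K , x≤e⊕k) =
    a , b ⊕ k , a∈I , (b , k , b∈J , k∈K , ≤-refl _) , x≤a⊕[b⊕k]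
    where
    open ≤-Reasoning
    x≤a⊕[b⊕k] : x ≤ a ⊕ (b ⊕ k)
    x≤a⊕[b⊕k] = begin
      x            ≲⟨ x≤e⊕k ⟩
      e ⊕ k        ≲⟨ ⊕-monoˡ-≤ k e≤a⊕b ⟩
      (a ⊕ b) ⊕ k  ≡⟨ ⊕-assoc a b k ⟩
      a ⊕ (b ⊕ k)  ∎

  [I⊕̄J]⊕̄K⊆[I⊕̄K]⊕̄J : ∀ {I J K : Pred Carrier c} → (I ⊕̄ J) ⊕̄ K ⊆ (I ⊕̄ K) ⊕̄ J
  [I⊕̄J]⊕̄K⊆[I⊕̄K]⊕̄J {x = x} (e , k , (a , b , a∈I , b∈J , e≤a⊕b) , k∈K , x≤e⊕k) =
    a ⊕ k , b , (a , k , a∈I , k∈K , ≤-refl _) , b∈J , x≤[a⊕k]⊕b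
    where
    open ≤-Reasoning
    x≤[a⊕k]⊕b : x ≤ (a ⊕ k) ⊕ b
    x≤[a⊕k]⊕b = begin
      x            ≲⟨ x≤e⊕k ⟩
      e ⊕ k        ≲⟨ ⊕-monoˡ-≤ k e≤a⊕b ⟩
      (a ⊕ b) ⊕ k  ≡⟨ xy∙z≈xz∙y a b k ⟩
      (a ⊕ k) ⊕ b  ∎

  ⊕̄-isLatticeIdeal : ∀ {I J : Pred Carrier c} →
    IsLatticeIdeal I → IsLatticeIdeal J → IsLatticeIdeal (I ⊕̄ J)
  ⊕̄-isLatticeIdeal I-ideal J-ideal = record
    { nonempty = 0# , 0# , 0# , 0∈ideal I-ideal , 0∈ideal J-ideal , 0≤x _
    ; downward = λ { y≤x (a , b , a∈I , b∈J , x≤a⊕b) → a , b , a∈I , b∈J , ≤-trans y≤x x≤a⊕b }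
    ; ∨-closed = λ { (a , b , a∈I , b∈J , x≤a⊕b) (a′ , b′ , a′∈I , b′∈J , y≤a′⊕b′) →
        a ∨ a′ , b ∨ b′ , ∨-closed I-ideal a∈I a′∈I , ∨-closed J-ideal b∈J b′∈J ,
        ∨-lub (≤-trans x≤a⊕b (⊕-mono-≤ (x≤x∨y a a′) (x≤x∨y b b′)))
              (≤-trans y≤a′⊕b′ (⊕-mono-≤ (x≤y∨x a′ a) (x≤y∨x b′ b))) }
    }
    where open IsLatticeIdeal

  ⊕̄-prime : ∀ {I J : Pred Carrier c} → IsPrimeLatticeIdeal I →
    ∀ {x y} → x ∧ y ∈ I ⊕̄ J → x ∈ I ⊕̄ J ⊎ y ∈ I ⊕̄ J
  ⊕̄-prime {I} {J} I-prime {x} {y} (a , b , a∈I , b∈J , x∧y≤a⊕b) =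
    Sum.map (witness x y x∧y≤a⊕b) (witness y x (subst (_≤ a ⊕ b) (∧-comm x y) x∧y≤a⊕b))
            (prime (downward bound a∈I))
    where
    open IsPrimeLatticeIdeal I-prime
    open IsLatticeIdeal isLatticeIdeal
    open ≤-Reasoning

    bound : (a ⊕ (x ⊖ y)) ∧ (a ⊕ (y ⊖ x)) ≤ a
    bound = begin
      (a ⊕ (x ⊖ y)) ∧ (a ⊕ (y ⊖ x))  ≲⟨ [x⊕y]∧[x⊕z]≤x⊕[y∧z] a _ _ ⟩
      a ⊕ ((x ⊖ y) ∧ (y ⊖ x))        ≡⟨ cong (a ⊕_) ([x⊖y]∧[y⊖x]≡0 x y) ⟩
      a ⊕ 0#                         ≡⟨ ⊕-identityʳ a ⟩
      a                              ∎

    witness : ∀ u v → u ∧ v ≤ a ⊕ b → a ⊕ (u ⊖ v) ∈ I → u ∈ I ⊕̄ J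
    witness u v u∧v≤a⊕b a⊕[u⊖v]∈I = a ⊕ (u ⊖ v) , b , a⊕[u⊖v]∈I , b∈J , (begin
      u                    ≡⟨ [x⊖y]⊕[x∧y]≡x u v ⟨
      (u ⊖ v) ⊕ (u ∧ v)    ≡⟨ ⊕-comm _ _ ⟩
      (u ∧ v) ⊕ (u ⊖ v)    ≲⟨ ⊕-monoˡ-≤ (u ⊖ v) u∧v≤a⊕b ⟩
      (a ⊕ b) ⊕ (u ⊖ v)    ≡⟨ xy∙z≈xz∙y a b (u ⊖ v) ⟩
      (a ⊕ (u ⊖ v)) ⊕ b    ∎)

  ⊕̄-isPrimeLatticeIdeal : ∀ {I J : Pred Carrier c} → IsPrimeLatticeIdeal I → IsLatticeIdeal J →
    ∃ (_∉ I ⊕̄ J) → IsPrimeLatticeIdeal (I ⊕̄ J)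
  ⊕̄-isPrimeLatticeIdeal I-prime J-ideal I⊕̄J-proper = record
    { isLatticeIdeal = ⊕̄-isLatticeIdeal (IsPrimeLatticeIdeal.isLatticeIdeal I-prime) J-ideal
    ; proper = I⊕̄J-proper
    ; prime = ⊕̄-prime I-prime
    }

lemma7p10 : ∀ {c : Level} (A : MVAlgebra c) → let open MVAlgebra A in
    (I I′ : Pred Carrier c) → IsPrimeLatticeIdeal I → IsPrimeLatticeIdeal I′ → I ⊆ I′ →
    Σ (Pred Carrier c) λ I″ → IsPrimeLatticeIdeal I″ × I ⊆ I″ × I″ ⊆ I′ ×
    (∀ (K K′ K″ : Pred Carrier c) → IsK I K → IsK I′ K′ → IsK I″ K″ →
    K ⊆ K″ × K′ ⊆ K″)
lemma7p10 {c} A I I′ I-prime I′-prime I⊆I′ =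
  I″ , I″-prime , ⊆-⊕̄ (0∈ideal S-ideal) , I″⊆I′ , k-between
  where
  open MVAlgebra A
  open IdealArithmetic A
  open IsPrimeLatticeIdeal

  I′-ideal : IsLatticeIdeal I′
  I′-ideal = isLatticeIdeal I′-prime

  S-ideal : IsLatticeIdeal (Stab I′)
  S-ideal = Stab-isLatticeIdeal I′-ideal

  I″ : Pred Carrier c
  I″ = I ⊕̄ Stab I′

  I″⊆I′ : I″ ⊆ I′
  I″⊆I′ = ⊕̄-Stab-⊆ I′-ideal ∘ ⊕̄-monoˡ I⊆I′

  I″-prime : IsPrimeLatticeIdeal I″
  I″-prime = ⊕̄-isPrimeLatticeIdeal I-prime S-ideal
    (let (a , a∉I′) = proper I′-prime in a , a∉I′ ∘ I″⊆I′)

  k-between : ∀ (K K′ K″ : Pred Carrier c) → IsK I K → IsK I′ K′ → IsK I″ K″ →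
    K ⊆ K″ × K′ ⊆ K″
  k-between K K′ K″ (K-ideal , I⊕̄K⊆I , _) (K′-ideal , I′⊕̄K′⊆I′ , _) (_ , _ , K″-largest) =
    K″-largest K K-ideal
      (⊕̄-monoˡ I⊕̄K⊆I ∘ [I⊕̄J]⊕̄K⊆[I⊕̄K]⊕̄J) ,
    K″-largest K′ K′-ideal
      (⊕̄-monoʳ (Stab-absorbs I′-ideal I′⊕̄K′⊆I′) ∘ [I⊕̄J]⊕̄K⊆I⊕̄[J⊕̄K])
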